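{- For $N\ge 1$ let $a_N$ be the number of tilings of the $2\times 3\times N$ box by $1\times2\times 3$ bricks, and $a_0=1$. Then $$\sum_{N\ge 0} a_N z^N=\frac{1}{1-z-z^2-3z^3}=1+z+2z^2+6z^3+11z^4+23z^5+\cdots.$$
   Context: A tiling of a $k\times m\times n$ box (made of $kmn$ unit cubes) by $t_1\times t_2\times t_3$ bricks is a set of non-overlapping axis-parallel boxes with integer corners, each congruent to the brick (i.e. of dimensions some permutation of $(t_1,t_2,t_3)$; all orientations may be mixed), whose union is the box. Tilings related by a symmetry of the box are counted separately. $N$ is the number of bricks used (here equal to the length of the box). -}

module Defs where

open import Data.Bool using (Bool; true; false; _∧_)
open import Data.Nat using (ℕ; zero; suc; _+_; _∸_; _≤ᵇ_; _<ᵇ_; _≡ᵇ_)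
open import Data.List using (List; []; _∷_; map; concatMap; filterᵇ; length; upTo; _++_)
open import Data.Product using (_×_; _,_)
open import Data.Integer as ℤ using (ℤ; +_; -_)

-- A brick placement: lower corner (x , y , z) and side lengths (d₁ , d₂ , d₃)
-- along the three axes.  The box is [0,2) × [0,3) × [0,N).
record Brick : Set where
  constructor brick
  field
    x y z    : ℕ
    d₁ d₂ d₃ : ℕ
open Brick public

orientations : List (ℕ × ℕ × ℕ)
orientations =
  (1 , 2 , 3) ∷ (1 , 3 , 2) ∷ (2 , 1 , 3) ∷ (2 , 3 , 1) ∷ (3 , 1 , 2) ∷ (3 , 2 , 1) ∷ []

fits : ℕ → Brick → Bool
fits N b = ((x b + d₁ b) ≤ᵇ 2) ∧ (((y b + d₂ b) ≤ᵇ 3) ∧ ((z b + d₃ b) ≤ᵇ N))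

placements : ℕ → List Brick
placements N =
  filterᵇ (fits N)
    (concatMap (λ { (a , b , c) →
      concatMap (λ i → concatMap (λ j → map (λ k → brick i j k a b c) (upTo N)) (upTo 3)) (upTo 2) })
      orientations)

-- unit cells of the box, indexed by their lower corner
Cell : Set
Cell = ℕ × ℕ × ℕ

cells : ℕ → List Cell
cells N = concatMap (λ i → concatMap (λ j → map (λ k → (i , j , k)) (upTo N)) (upTo 3)) (upTo 2)

covers : Brick → Cell → Bool
covers b (i , j , k) =
  ((x b ≤ᵇ i) ∧ (i <ᵇ (x b + d₁ b))) ∧
  (((y b ≤ᵇ j) ∧ (j <ᵇ (y b + d₂ b))) ∧ ((z b ≤ᵇ k) ∧ (k <ᵇ (z b + d₃ b))))

sublists : {A : Set} → List A → List (List A)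
sublists [] = [] ∷ []
sublists (a ∷ as) = let r = sublists as in map (a ∷_) r ++ r

allᵇ : {A : Set} → (A → Bool) → List A → Bool
allᵇ f [] = true
allᵇ f (v ∷ vs) = f v ∧ allᵇ f vs

isTiling : ℕ → List Brick → Bool
isTiling N S = allᵇ (λ c → length (filterᵇ (λ b → covers b c) S) ≡ᵇ 1) (cells N)

a : ℕ → ℕ
a zero = 1
a (suc n) = length (filterᵇ (isTiling (suc n)) (sublists (placements (suc n))))

p : ℕ → ℤ
p 0 = + 1
p 1 = - (+ 1)
p 2 = - (+ 1)
p 3 = - (+ 3)
p _ = + 0

one : ℕ → ℤ
one 0 = + 1
one _ = + 0

sumℤ : List ℤ → ℤ
sumℤ [] = + 0
sumℤ (v ∷ vs) = v ℤ.+ sumℤ vs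

-- N-th coefficient of the formal power-series product f · g
conv : (ℕ → ℤ) → (ℕ → ℤ) → ℕ → ℤ
conv f g N = sumℤ (map (λ i → f i ℤ.* g (N ∸ i)) (upTo (suc N)))

-- Cut the box along the horizontal planes z = k and build a tiling layer by
-- layer.  The bricks crossing the plane z = 1, pushed down by one unit, form a
-- state; the number of ways to complete a state depends only on the state and
-- on the remaining height, which yields a transfer-matrix recursion.  From the
-- empty state the floor layer can be filled in exactly five ways: by a 2×3×1
-- slab (empty state again after one layer), by two 1×3×2 bricks (empty state
-- after two layers), or in three ways by upright bricks of height 3 (empty
-- state after three layers).  Hence a(N) = a(N-1) + a(N-2) + 3 a(N-3) for
-- N ≥ 4, and with a₀, …, a₃ = 1, 1, 2, 6 this is the coefficient identity
-- (1 - z - z² - 3z³) Σ a_N z^N = 1.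
module Submission where

open import Defs
open import Data.Nat using (ℕ)
open import Data.Integer using (+_)
open import Relation.Binary.PropositionalEquality using (_≡_)

import Algebra.Properties.CommutativeSemigroup as CommutativeSemigroupProperties
open import Algebra.Bundles using (CommutativeMonoid)
open import Data.Bool using (Bool; true; false; _∧_; if_then_else_)
open import Data.Bool.Properties using (∧-zeroʳ; ∧-assoc; ∧-commutativeMonoid)
open import Data.Integer as ℤ using (ℤ; -_)
open import Data.Integer.Properties using (*-zeroˡ; pos-+; pos-*)
import Data.Integer.Tactic.RingSolver as ℤ-Solver
open import Data.List
  using (List; []; _∷_; map; concatMap; filterᵇ; length; upTo; applyUpTo; _++_)
open import Data.List.Properties
  using (length-++; length-map; map-++; map-∘; map-cong; ++-assoc; filter-++; map-applyUpTo)
open import Data.List.Relation.Binary.Permutation.Propositional as Perm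
  using (_↭_; ↭-reflexive; module PermutationReasoning)
import Data.List.Relation.Binary.Permutation.Propositional.Properties as ↭
open import Data.List.Relation.Unary.All using (All; []; _∷_)
open import Data.Nat using (zero; suc; _+_; _*_; _∸_; _≤ᵇ_; _<ᵇ_; _≡ᵇ_)
open import Data.Nat.ListAction using (sum)
open import Data.Nat.ListAction.Properties using (sum-++)
open import Data.Nat.Properties using (+-identityʳ; +-commutativeSemigroup)
open import Data.Nat.Tactic.RingSolver using (solve-∀)
open import Data.Product using (_×_; _,_)
open import Function using (_∘_)
open import Relation.Binary.PropositionalEquality
  using (refl; cong; cong₂; sym; trans; module ≡-Reasoning)
open import Relation.Nullary.Decidable using (T?)

open CommutativeSemigroupProperties +-commutativeSemigroup using (interchange)

<ᵇ-suc : ∀ m n → (m <ᵇ suc n) ≡ (m ≤ᵇ n)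
<ᵇ-suc zero    n = refl
<ᵇ-suc (suc m) n = refl

≤ᵇ-∧->ᵇ : ∀ m n → ((m ≤ᵇ n) ∧ (n <ᵇ m)) ≡ false
≤ᵇ-∧->ᵇ zero    n       = refl
≤ᵇ-∧->ᵇ (suc m) zero    = refl
≤ᵇ-∧->ᵇ (suc m) (suc n) = trans (cong (_∧ (n <ᵇ m)) (<ᵇ-suc m n)) (≤ᵇ-∧->ᵇ m n)

∧-∧-false : ∀ b c → (b ∧ (c ∧ false)) ≡ false
∧-∧-false b c = trans (cong (b ∧_) (∧-zeroʳ c)) (∧-zeroʳ b)

filterᵇ-cong : ∀ {A : Set} {p q : A → Bool} → (∀ x → p x ≡ q x) → ∀ xs → filterᵇ p xs ≡ filterᵇ q xs
filterᵇ-cong             e []       = refl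
filterᵇ-cong {p = p} {q} e (x ∷ xs) with p x | q x | e x
... | true  | .true  | refl = cong (x ∷_) (filterᵇ-cong e xs)
... | false | .false | refl = filterᵇ-cong e xs

filterᵇ-map : ∀ {A B : Set} (p : B → Bool) (f : A → B) xs →
              filterᵇ p (map f xs) ≡ map f (filterᵇ (p ∘ f) xs)
filterᵇ-map p f []       = refl
filterᵇ-map p f (x ∷ xs) with p (f x)
... | true  = cong (f x ∷_) (filterᵇ-map p f xs)
... | false = filterᵇ-map p f xs

filterᵇ-false : ∀ {A : Set} (xs : List A) → filterᵇ (λ _ → false) xs ≡ []
filterᵇ-false []       = refl
filterᵇ-false (x ∷ xs) = filterᵇ-false xs

filterᵇ-filterᵇ : ∀ {A : Set} (p q : A → Bool) → (∀ x → q x ≡ false → p x ≡ false) →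
                  ∀ xs → filterᵇ p (filterᵇ q xs) ≡ filterᵇ p xs
filterᵇ-filterᵇ p q p⇒q []       = refl
filterᵇ-filterᵇ p q p⇒q (x ∷ xs) with q x in qx
... | true with p x
...   | true  = cong (x ∷_) (filterᵇ-filterᵇ p q p⇒q xs)
...   | false = filterᵇ-filterᵇ p q p⇒q xs
filterᵇ-filterᵇ p q p⇒q (x ∷ xs) | false rewrite p⇒q x qx = filterᵇ-filterᵇ p q p⇒q xs

allᵇ-cong : ∀ {A : Set} {f g : A → Bool} → (∀ x → f x ≡ g x) → ∀ xs → allᵇ f xs ≡ allᵇ g xs
allᵇ-cong e []       = refl
allᵇ-cong e (x ∷ xs) = cong₂ _∧_ (e x) (allᵇ-cong e xs)

allᵇ-cong-local : ∀ {A : Set} {f g : A → Bool} {xs} → All (λ x → f x ≡ g x) xs → allᵇ f xs ≡ allᵇ g xs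
allᵇ-cong-local []       = refl
allᵇ-cong-local (e ∷ es) = cong₂ _∧_ e (allᵇ-cong-local es)

allᵇ-++ : ∀ {A : Set} (f : A → Bool) xs ys → allᵇ f (xs ++ ys) ≡ (allᵇ f xs ∧ allᵇ f ys)
allᵇ-++ f []       ys = refl
allᵇ-++ f (x ∷ xs) ys = trans (cong (f x ∧_) (allᵇ-++ f xs ys)) (sym (∧-assoc (f x) (allᵇ f xs) (allᵇ f ys)))

allᵇ-map : ∀ {A B : Set} (f : B → Bool) (g : A → B) xs → allᵇ f (map g xs) ≡ allᵇ (f ∘ g) xs
allᵇ-map f g []       = refl
allᵇ-map f g (x ∷ xs) = cong (f (g x) ∧_) (allᵇ-map f g xs)

allᵇ-↭ : ∀ {A : Set} (f : A → Bool) {xs ys} → xs ↭ ys → allᵇ f xs ≡ allᵇ f ys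
allᵇ-↭ f Perm.refl           = refl
allᵇ-↭ f (Perm.prep x p)     = cong (f x ∧_) (allᵇ-↭ f p)
allᵇ-↭ f (Perm.swap x y p)   =
  trans (cong (λ b → f x ∧ (f y ∧ b)) (allᵇ-↭ f p)) (x∙yz≈y∙xz (f x) (f y) _)
  where open CommutativeSemigroupProperties (CommutativeMonoid.commutativeSemigroup ∧-commutativeMonoid)
          using (x∙yz≈y∙xz)
allᵇ-↭ f (Perm.trans p q)    = trans (allᵇ-↭ f p) (allᵇ-↭ f q)

sum-map-if : ∀ {A : Set} (f : A → Bool) (h : A → ℕ) xs →
             sum (map (λ x → if f x then h x else 0) xs) ≡ sum (map h (filterᵇ f xs))
sum-map-if f h []       = refl
sum-map-if f h (x ∷ xs) with f x
... | true  = cong (_+_ (h x)) (sum-map-if f h xs)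
... | false = sum-map-if f h xs

countSublists : {A : Set} → (List A → Bool) → List A → ℕ
countSublists Q L = length (filterᵇ Q (sublists L))

module _ {A : Set} where

  countSublists-cong : ∀ {Q Q' : List A → Bool} → (∀ S → Q S ≡ Q' S) → ∀ L →
                       countSublists Q L ≡ countSublists Q' L
  countSublists-cong e L = cong length (filterᵇ-cong e (sublists L))

  countSublists-∷ : ∀ (Q : List A → Bool) x L →
                    countSublists Q (x ∷ L) ≡ countSublists (Q ∘ (x ∷_)) L + countSublists Q L
  countSublists-∷ Q x L = begin
    length (filterᵇ Q (map (x ∷_) (sublists L) ++ sublists L))
      ≡⟨ cong length (filter-++ (T? ∘ Q) (map (x ∷_) (sublists L)) (sublists L)) ⟩
    length (filterᵇ Q (map (x ∷_) (sublists L)) ++ filterᵇ Q (sublists L))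
      ≡⟨ length-++ (filterᵇ Q (map (x ∷_) (sublists L))) ⟩
    length (filterᵇ Q (map (x ∷_) (sublists L))) + countSublists Q L
      ≡⟨ cong (λ n → length n + countSublists Q L) (filterᵇ-map Q (x ∷_) (sublists L)) ⟩
    length (map (x ∷_) (filterᵇ (Q ∘ (x ∷_)) (sublists L))) + countSublists Q L
      ≡⟨ cong (_+ countSublists Q L) (length-map (x ∷_) (filterᵇ (Q ∘ (x ∷_)) (sublists L))) ⟩
    countSublists (Q ∘ (x ∷_)) L + countSublists Q L ∎
    where open ≡-Reasoning

  Respects↭ : (List A → Bool) → Set
  Respects↭ Q = ∀ {S S'} → S ↭ S' → Q S ≡ Q S'

  countSublists-↭ : ∀ {L L'} → L ↭ L' → ∀ Q → Respects↭ Q → countSublists Q L ≡ countSublists Q L'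
  countSublists-↭ Perm.refl Q resp = refl
  countSublists-↭ {x ∷ L} {x ∷ L'} (Perm.prep x p) Q resp = begin
    countSublists Q (x ∷ L)                                  ≡⟨ countSublists-∷ Q x L ⟩
    countSublists (Q ∘ (x ∷_)) L + countSublists Q L
      ≡⟨ cong₂ _+_ (countSublists-↭ p (Q ∘ (x ∷_)) (resp ∘ Perm.prep x)) (countSublists-↭ p Q resp) ⟩
    countSublists (Q ∘ (x ∷_)) L' + countSublists Q L'       ≡⟨ countSublists-∷ Q x L' ⟨
    countSublists Q (x ∷ L') ∎
    where open ≡-Reasoning
  countSublists-↭ {x ∷ y ∷ L} {y ∷ x ∷ L'} (Perm.swap x y p) Q resp = begin
    countSublists Q (x ∷ y ∷ L)                              ≡⟨ expand x y L ⟩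
    (c (Q ∘ (x ∷_) ∘ (y ∷_)) L + c (Q ∘ (x ∷_)) L) + (c (Q ∘ (y ∷_)) L + c Q L)
      ≡⟨ cong₂ _+_ (cong₂ _+_ (trans (countSublists-↭ p _ (resp ∘ Perm.prep x ∘ Perm.prep y)) swapped)
                              (countSublists-↭ p _ (resp ∘ Perm.prep x)))
                   (cong₂ _+_ (countSublists-↭ p _ (resp ∘ Perm.prep y)) (countSublists-↭ p Q resp)) ⟩
    (c (Q ∘ (y ∷_) ∘ (x ∷_)) L' + c (Q ∘ (x ∷_)) L') + (c (Q ∘ (y ∷_)) L' + c Q L')
      ≡⟨ interchange (c (Q ∘ (y ∷_) ∘ (x ∷_)) L') (c (Q ∘ (x ∷_)) L') (c (Q ∘ (y ∷_)) L') (c Q L') ⟩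
    (c (Q ∘ (y ∷_) ∘ (x ∷_)) L' + c (Q ∘ (y ∷_)) L') + (c (Q ∘ (x ∷_)) L' + c Q L')
      ≡⟨ expand y x L' ⟨
    countSublists Q (y ∷ x ∷ L') ∎
    where
    open ≡-Reasoning
    c : (List A → Bool) → List A → ℕ
    c = countSublists
    expand : ∀ u v M → c Q (u ∷ v ∷ M) ≡ (c (Q ∘ (u ∷_) ∘ (v ∷_)) M + c (Q ∘ (u ∷_)) M) + (c (Q ∘ (v ∷_)) M + c Q M)
    expand u v M = trans (countSublists-∷ Q u (v ∷ M))
                         (cong₂ _+_ (countSublists-∷ (Q ∘ (u ∷_)) v M) (countSublists-∷ Q v M))
    swapped : c (Q ∘ (x ∷_) ∘ (y ∷_)) L' ≡ c (Q ∘ (y ∷_) ∘ (x ∷_)) L'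
    swapped = countSublists-cong (λ S → resp (Perm.swap x y Perm.refl)) L'
  countSublists-↭ (Perm.trans p q) Q resp = trans (countSublists-↭ p Q resp) (countSublists-↭ q Q resp)

  countSublists-++ : ∀ X Y (Q : List A → Bool) →
                     countSublists Q (X ++ Y) ≡ sum (map (λ S₀ → countSublists (Q ∘ (S₀ ++_)) Y) (sublists X))
  countSublists-++ []      Y Q = sym (+-identityʳ (countSublists Q Y))
  countSublists-++ (x ∷ X) Y Q = begin
    countSublists Q (x ∷ X ++ Y)
      ≡⟨ countSublists-∷ Q x (X ++ Y) ⟩
    countSublists (Q ∘ (x ∷_)) (X ++ Y) + countSublists Q (X ++ Y)
      ≡⟨ cong₂ _+_ (countSublists-++ X Y (Q ∘ (x ∷_))) (countSublists-++ X Y Q) ⟩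
    sum (map (F ∘ (x ∷_)) (sublists X)) + sum (map F (sublists X))
      ≡⟨ cong (λ l → sum l + sum (map F (sublists X))) (map-∘ (sublists X)) ⟩
    sum (map F (map (x ∷_) (sublists X))) + sum (map F (sublists X))
      ≡⟨ sum-++ (map F (map (x ∷_) (sublists X))) (map F (sublists X)) ⟨
    sum (map F (map (x ∷_) (sublists X)) ++ map F (sublists X))
      ≡⟨ cong sum (map-++ F (map (x ∷_) (sublists X)) (sublists X)) ⟨
    sum (map F (sublists (x ∷ X))) ∎
    where
    open ≡-Reasoning
    F : List A → ℕ
    F S₀ = countSublists (Q ∘ (S₀ ++_)) Y

  countSublists-∧ : ∀ b (Q : List A → Bool) L →
                    countSublists (λ S → b ∧ Q S) L ≡ (if b then countSublists Q L else 0)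
  countSublists-∧ true  Q L = refl
  countSublists-∧ false Q L = cong length (filterᵇ-false (sublists L))

countSublists-map : ∀ {A B : Set} (f : B → A) (Q : List A → Bool) L →
                    countSublists Q (map f L) ≡ countSublists (Q ∘ map f) L
countSublists-map f Q []      with Q []
... | true  = refl
... | false = refl
countSublists-map f Q (x ∷ L) = begin
  countSublists Q (f x ∷ map f L)
    ≡⟨ countSublists-∷ Q (f x) (map f L) ⟩
  countSublists (Q ∘ (f x ∷_)) (map f L) + countSublists Q (map f L)
    ≡⟨ cong₂ _+_ (countSublists-map f (Q ∘ (f x ∷_)) L) (countSublists-map f Q L) ⟩
  countSublists (Q ∘ map f ∘ (x ∷_)) L + countSublists (Q ∘ map f) L
    ≡⟨ countSublists-∷ (Q ∘ map f) x L ⟨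
  countSublists (Q ∘ map f) (x ∷ L) ∎
  where open ≡-Reasoning

concatMap-split : ∀ {A B : Set} (u : B → B) (F H T : A → List B) →
                  (∀ x → F x ↭ H x ++ map u (T x)) →
                  ∀ xs → concatMap F xs ↭ concatMap H xs ++ map u (concatMap T xs)
concatMap-split         u F H T split []       = Perm.refl
concatMap-split {B = B} u F H T split (x ∷ xs) = begin
  F x ++ concatMap F xs
    ↭⟨ ↭.++⁺ (split x) (concatMap-split u F H T split xs) ⟩
  (H x ++ map u (T x)) ++ (concatMap H xs ++ map u (concatMap T xs))
    ↭⟨ interchange-↭ (H x) (map u (T x)) (concatMap H xs) (map u (concatMap T xs)) ⟩
  (H x ++ concatMap H xs) ++ (map u (T x) ++ map u (concatMap T xs))
    ≡⟨ cong ((H x ++ concatMap H xs) ++_) (map-++ u (T x) (concatMap T xs)) ⟨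
  concatMap H (x ∷ xs) ++ map u (concatMap T (x ∷ xs)) ∎
  where
  open PermutationReasoning
  open CommutativeSemigroupProperties
         (CommutativeMonoid.commutativeSemigroup (↭.++-commutativeMonoid {A = B}))
         renaming (interchange to interchange-↭)

map-upTo-suc : ∀ {B : Set} (h : ℕ → B) (u : B → B) → (∀ k → u (h k) ≡ h (suc k)) →
               ∀ N → map h (upTo (suc N)) ≡ h 0 ∷ map u (map h (upTo N))
map-upTo-suc h u shift N = cong (h 0 ∷_) (begin
  map h (applyUpTo suc N)        ≡⟨ cong (map h) (map-applyUpTo (λ k → k) suc N) ⟨
  map h (map suc (upTo N))       ≡⟨ map-∘ (upTo N) ⟨
  map (h ∘ suc) (upTo N)         ≡⟨ map-cong (λ k → sym (shift k)) (upTo N) ⟩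
  map (u ∘ h) (upTo N)           ≡⟨ map-∘ (upTo N) ⟩
  map u (map h (upTo N)) ∎)
  where open ≡-Reasoning

grid-↭ : ∀ {B : Set} m n (h : ℕ → ℕ → ℕ → B) (u : B → B) → (∀ i j k → u (h i j k) ≡ h i j (suc k)) → ∀ N →
         concatMap (λ i → concatMap (λ j → map (h i j) (upTo (suc N))) (upTo n)) (upTo m)
         ↭ concatMap (λ i → concatMap (λ j → h i j 0 ∷ []) (upTo n)) (upTo m)
           ++ map u (concatMap (λ i → concatMap (λ j → map (h i j) (upTo N)) (upTo n)) (upTo m))
grid-↭ m n h u shift N =
  concatMap-split u _ _ _
    (λ i → concatMap-split u _ _ _
      (λ j → ↭-reflexive (map-upTo-suc (h i j) u (shift i j) N)) (upTo n))
    (upTo m)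

raise : Brick → Brick
raise (brick x y z d₁ d₂ d₃) = brick x y (suc z) d₁ d₂ d₃

raiseCell : Cell → Cell
raiseCell (i , j , k) = (i , j , suc k)

-- A brick on the floor loses its bottom layer; it may thereby become flat.
lower : Brick → Brick
lower (brick x y zero    d₁ d₂ d₃) = brick x y 0 d₁ d₂ (d₃ ∸ 1)
lower (brick x y (suc z) d₁ d₂ d₃) = brick x y z d₁ d₂ d₃

isThick : Brick → Bool
isThick (brick _ _ _ _ _ zero)    = false
isThick (brick _ _ _ _ _ (suc _)) = true

pushDown : List Brick → List Brick
pushDown R = filterᵇ isThick (map lower R)

covers-flat : ∀ b c → isThick b ≡ false → covers b c ≡ false
covers-flat (brick x y z d₁ d₂ zero) (i , j , k) _ rewrite +-identityʳ z | ≤ᵇ-∧->ᵇ z k =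
  ∧-∧-false ((x ≤ᵇ i) ∧ (i <ᵇ x + d₁)) ((y ≤ᵇ j) ∧ (j <ᵇ y + d₂))

covers-lower : ∀ b c → covers (lower b) c ≡ covers b (raiseCell c)
covers-lower (brick x y zero    d₁ d₂ zero)      (i , j , k) = refl
covers-lower (brick x y zero    d₁ d₂ (suc d₃))  (i , j , k) = refl
covers-lower (brick x y (suc z) d₁ d₂ d₃)        (i , j , k) =
  cong (λ b → ((x ≤ᵇ i) ∧ (i <ᵇ x + d₁)) ∧ (((y ≤ᵇ j) ∧ (j <ᵇ y + d₂)) ∧ (b ∧ (k <ᵇ z + d₃))))
       (sym (<ᵇ-suc z k))

covers-raise : ∀ b c → covers (raise b) (raiseCell c) ≡ covers b c
covers-raise (brick x y z d₁ d₂ d₃) (i , j , k) =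
  cong (λ b → ((x ≤ᵇ i) ∧ (i <ᵇ x + d₁)) ∧ (((y ≤ᵇ j) ∧ (j <ᵇ y + d₂)) ∧ (b ∧ (k <ᵇ z + d₃))))
       (<ᵇ-suc z k)

covers-raise-floor : ∀ b i j → covers (raise b) (i , j , 0) ≡ false
covers-raise-floor (brick x y z d₁ d₂ d₃) i j =
  ∧-∧-false ((x ≤ᵇ i) ∧ (i <ᵇ x + d₁)) ((y ≤ᵇ j) ∧ (j <ᵇ y + d₂))

fits-raise : ∀ N b → fits (suc N) (raise b) ≡ fits N b
fits-raise N (brick x y z d₁ d₂ d₃) =
  cong (λ b → ((x + d₁) ≤ᵇ 2) ∧ (((y + d₂) ≤ᵇ 3) ∧ b)) (<ᵇ-suc (z + d₃) N)

coverCount : List Brick → Cell → ℕ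
coverCount S c = length (filterᵇ (λ b → covers b c) S)

coverCount-++ : ∀ R S c → coverCount (R ++ S) c ≡ coverCount R c + coverCount S c
coverCount-++ R S c =
  trans (cong length (filter-++ (T? ∘ (λ b → covers b c)) R S))
        (length-++ (filterᵇ (λ b → covers b c) R))

coverCount-map : ∀ (f : Brick → Brick) S c c' → (∀ b → covers (f b) c ≡ covers b c') →
                 coverCount (map f S) c ≡ coverCount S c'
coverCount-map f S c c' e = begin
  length (filterᵇ (λ b → covers b c) (map f S))       ≡⟨ cong length (filterᵇ-map (λ b → covers b c) f S) ⟩
  length (map f (filterᵇ (λ b → covers (f b) c) S))   ≡⟨ length-map f (filterᵇ (λ b → covers (f b) c) S) ⟩
  length (filterᵇ (λ b → covers (f b) c) S)           ≡⟨ cong length (filterᵇ-cong e S) ⟩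
  coverCount S c' ∎
  where open ≡-Reasoning

coverCount-raise : ∀ S c → coverCount (map raise S) (raiseCell c) ≡ coverCount S c
coverCount-raise S c = coverCount-map raise S (raiseCell c) c (λ b → covers-raise b c)

coverCount-raise-floor : ∀ S i j → coverCount (map raise S) (i , j , 0) ≡ 0
coverCount-raise-floor S i j = cong length (begin
  filterᵇ (λ b → covers b (i , j , 0)) (map raise S)            ≡⟨ filterᵇ-map (λ b → covers b (i , j , 0)) raise S ⟩
  map raise (filterᵇ (λ b → covers (raise b) (i , j , 0)) S)    ≡⟨ cong (map raise) (filterᵇ-cong (λ b → covers-raise-floor b i j) S) ⟩
  map raise (filterᵇ (λ _ → false) S)                           ≡⟨ cong (map raise) (filterᵇ-false S) ⟩
  [] ∎)
  where open ≡-Reasoning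

coverCount-pushDown : ∀ R c → coverCount (pushDown R) c ≡ coverCount R (raiseCell c)
coverCount-pushDown R c =
  trans (cong length (filterᵇ-filterᵇ (λ b → covers b c) isThick (λ b → covers-flat b c) (map lower R)))
        (coverCount-map lower R c (raiseCell c) (λ b → covers-lower b c))

coverCount-↭ : ∀ {R R'} → R ↭ R' → ∀ c → coverCount R c ≡ coverCount R' c
coverCount-↭ p c = ↭.↭-length (↭.filter-↭ (T? ∘ (λ b → covers b c)) p)

floorPlacementsOf : ℕ × ℕ × ℕ → List Brick
floorPlacementsOf (d₁ , d₂ , d₃) =
  concatMap (λ i → concatMap (λ j → brick i j 0 d₁ d₂ d₃ ∷ []) (upTo 3)) (upTo 2)

floorCandidates : List Brick
floorCandidates = concatMap floorPlacementsOf orientations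

floorPlacements : ℕ → List Brick
floorPlacements N = filterᵇ (fits N) floorCandidates

floorCells : List Cell
floorCells = concatMap (λ i → concatMap (λ j → (i , j , 0) ∷ []) (upTo 3)) (upTo 2)

filterᵇ-fits-↭ : ∀ N {X Y} → X ↭ floorCandidates ++ map raise Y →
                 filterᵇ (fits (suc N)) X ↭ floorPlacements (suc N) ++ map raise (filterᵇ (fits N) Y)
filterᵇ-fits-↭ N {X} {Y} X↭ = begin
  filterᵇ (fits (suc N)) X
    ↭⟨ ↭.filter-↭ (T? ∘ fits (suc N)) X↭ ⟩
  filterᵇ (fits (suc N)) (floorCandidates ++ map raise Y)
    ≡⟨ filter-++ (T? ∘ fits (suc N)) floorCandidates (map raise Y) ⟩
  floorPlacements (suc N) ++ filterᵇ (fits (suc N)) (map raise Y)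
    ≡⟨ cong (floorPlacements (suc N) ++_) (filterᵇ-map (fits (suc N)) raise Y) ⟩
  floorPlacements (suc N) ++ map raise (filterᵇ (fits (suc N) ∘ raise) Y)
    ≡⟨ cong (λ l → floorPlacements (suc N) ++ map raise l) (filterᵇ-cong (fits-raise N) Y) ⟩
  floorPlacements (suc N) ++ map raise (filterᵇ (fits N) Y) ∎
  where open PermutationReasoning

placements-↭ : ∀ N → placements (suc N) ↭ floorPlacements (suc N) ++ map raise (placements N)
placements-↭ N =
  filterᵇ-fits-↭ N
    (concatMap-split raise _ floorPlacementsOf _
      (λ { (d₁ , d₂ , d₃) → grid-↭ 2 3 (λ i j k → brick i j k d₁ d₂ d₃) raise (λ _ _ _ → refl) N })
      orientations)

cells-↭ : ∀ N → cells (suc N) ↭ floorCells ++ map raiseCell (cells N)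
cells-↭ = grid-↭ 2 3 (λ i j k → (i , j , k)) raiseCell (λ _ _ _ → refl)

coversFloorOnce : List Brick → Bool
coversFloorOnce R = allᵇ (λ c → coverCount R c ≡ᵇ 1) floorCells

isTiling-floor : ∀ N R S → isTiling (suc N) (R ++ map raise S) ≡ (coversFloorOnce R ∧ isTiling N (pushDown R ++ S))
isTiling-floor N R S = begin
  allᵇ once (cells (suc N))
    ≡⟨ allᵇ-↭ once (cells-↭ N) ⟩
  allᵇ once (floorCells ++ map raiseCell (cells N))
    ≡⟨ allᵇ-++ once floorCells (map raiseCell (cells N)) ⟩
  allᵇ once floorCells ∧ allᵇ once (map raiseCell (cells N))
    ≡⟨ cong₂ _∧_ (allᵇ-cong-local {f = once} {g = λ c → coverCount R c ≡ᵇ 1}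
                   (floor 0 0 ∷ floor 0 1 ∷ floor 0 2 ∷ floor 1 0 ∷ floor 1 1 ∷ floor 1 2 ∷ []))
                 (trans (allᵇ-map once raiseCell (cells N)) (allᵇ-cong above (cells N))) ⟩
  coversFloorOnce R ∧ isTiling N (pushDown R ++ S) ∎
  where
  open ≡-Reasoning
  once : Cell → Bool
  once c = coverCount (R ++ map raise S) c ≡ᵇ 1
  floor : ∀ i j → once (i , j , 0) ≡ (coverCount R (i , j , 0) ≡ᵇ 1)
  floor i j = cong (_≡ᵇ 1) (begin
    coverCount (R ++ map raise S) (i , j , 0)                   ≡⟨ coverCount-++ R (map raise S) (i , j , 0) ⟩
    coverCount R (i , j , 0) + coverCount (map raise S) (i , j , 0)
      ≡⟨ cong (_+_ (coverCount R (i , j , 0))) (coverCount-raise-floor S i j) ⟩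
    coverCount R (i , j , 0) + 0                                ≡⟨ +-identityʳ _ ⟩
    coverCount R (i , j , 0) ∎)
  above : ∀ c → once (raiseCell c) ≡ (coverCount (pushDown R ++ S) c ≡ᵇ 1)
  above c = cong (_≡ᵇ 1) (begin
    coverCount (R ++ map raise S) (raiseCell c)                 ≡⟨ coverCount-++ R (map raise S) (raiseCell c) ⟩
    coverCount R (raiseCell c) + coverCount (map raise S) (raiseCell c)
      ≡⟨ cong₂ _+_ (sym (coverCount-pushDown R c)) (coverCount-raise S c) ⟩
    coverCount (pushDown R) c + coverCount S c                  ≡⟨ coverCount-++ (pushDown R) S c ⟨
    coverCount (pushDown R ++ S) c ∎)

-- The bricks of P are already placed and stick into the box from below.
completions : ℕ → List Brick → ℕ
completions N P = countSublists (λ S → isTiling N (P ++ S)) (placements N)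

successors : ℕ → List Brick → List (List Brick)
successors M P = map pushDown (filterᵇ coversFloorOnce (map (P ++_) (sublists (floorPlacements M))))

completions-suc : ∀ N P → completions (suc N) P ≡ sum (map (completions N) (successors (suc N) P))
completions-suc N P = begin
  countSublists Q (placements (suc N))
    ≡⟨ countSublists-↭ (placements-↭ N) Q respects ⟩
  countSublists Q (floorPlacements (suc N) ++ map raise (placements N))
    ≡⟨ countSublists-++ (floorPlacements (suc N)) (map raise (placements N)) Q ⟩
  sum (map (λ S₀ → countSublists (Q ∘ (S₀ ++_)) (map raise (placements N))) floor)
    ≡⟨ cong sum (map-cong layer floor) ⟩
  sum (map (guarded ∘ (P ++_)) floor)
    ≡⟨ cong sum (map-∘ floor) ⟩
  sum (map guarded (map (P ++_) floor))
    ≡⟨ sum-map-if coversFloorOnce (completions N ∘ pushDown) (map (P ++_) floor) ⟩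
  sum (map (completions N ∘ pushDown) (filterᵇ coversFloorOnce (map (P ++_) floor)))
    ≡⟨ cong sum (map-∘ (filterᵇ coversFloorOnce (map (P ++_) floor))) ⟩
  sum (map (completions N) (successors (suc N) P)) ∎
  where
  open ≡-Reasoning
  Q : List Brick → Bool
  Q S = isTiling (suc N) (P ++ S)
  floor : List (List Brick)
  floor = sublists (floorPlacements (suc N))
  respects : Respects↭ Q
  respects p = allᵇ-cong (λ c → cong (_≡ᵇ 1) (coverCount-↭ (↭.++⁺ˡ P p) c)) (cells (suc N))
  guarded : List Brick → ℕ
  guarded R = if coversFloorOnce R then completions N (pushDown R) else 0
  layer : ∀ S₀ → countSublists (Q ∘ (S₀ ++_)) (map raise (placements N)) ≡ guarded (P ++ S₀)
  layer S₀ = begin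
    countSublists (Q ∘ (S₀ ++_)) (map raise (placements N))
      ≡⟨ countSublists-map raise (Q ∘ (S₀ ++_)) (placements N) ⟩
    countSublists (λ S → isTiling (suc N) (P ++ S₀ ++ map raise S)) (placements N)
      ≡⟨ countSublists-cong (λ S → trans (cong (isTiling (suc N)) (sym (++-assoc P S₀ (map raise S))))
                                        (isTiling-floor N (P ++ S₀) S)) (placements N) ⟩
    countSublists (λ S → coversFloorOnce (P ++ S₀) ∧ isTiling N (pushDown (P ++ S₀) ++ S)) (placements N)
      ≡⟨ countSublists-∧ (coversFloorOnce (P ++ S₀)) (λ S → isTiling N (pushDown (P ++ S₀) ++ S)) (placements N) ⟩
    guarded (P ++ S₀) ∎

transfer : ℕ → List Brick → ℕ
transfer zero    P = 1
transfer (suc N) P = sum (map (transfer N) (successors (suc N) P))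

completions≡transfer : ∀ N P → completions N P ≡ transfer N P
completions≡transfer zero    P = refl
completions≡transfer (suc N) P =
  trans (completions-suc N P) (cong sum (map-cong (completions≡transfer N) (successors (suc N) P)))

a≡transfer : ∀ n → a n ≡ transfer n []
a≡transfer zero    = refl
a≡transfer (suc n) = completions≡transfer (suc n) []

transfer-forced : ∀ N P Q → successors (suc N) P ≡ Q ∷ [] → transfer (suc N) P ≡ transfer N Q
transfer-forced N P Q forced = trans (cong (sum ∘ map (transfer N)) forced) (+-identityʳ (transfer N Q))

-- The states reachable from the empty one: what is left, h layers high, of two
-- 1×3×2 bricks, or of three upright bricks of height 3 whose footprints are two
-- 1×2 rectangles and a 2×1 bar in the last or the first row, or three bars.
slabPair : ℕ → List Brick
slabPair h = brick 0 0 0 1 3 h ∷ brick 1 0 0 1 3 h ∷ []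

data Pillars : Set where
  bar-last bar-first bars : Pillars

pillars : Pillars → ℕ → List Brick
pillars bar-last  h = brick 0 0 0 1 2 h ∷ brick 1 0 0 1 2 h ∷ brick 0 2 0 2 1 h ∷ []
pillars bar-first h = brick 0 1 0 1 2 h ∷ brick 1 1 0 1 2 h ∷ brick 0 0 0 2 1 h ∷ []
pillars bars      h = brick 0 0 0 2 1 h ∷ brick 0 1 0 2 1 h ∷ brick 0 2 0 2 1 h ∷ []

successors-empty : ∀ n → successors (4 + n) [] ≡
  pillars bar-last 2 ∷ pillars bar-first 2 ∷ slabPair 1 ∷ pillars bars 2 ∷ [] ∷ []
successors-empty n = refl

successors-slabPair : ∀ n → successors (3 + n) (slabPair 1) ≡ [] ∷ []
successors-slabPair n = refl

successors-pillars₂ : ∀ π n → successors (3 + n) (pillars π 2) ≡ pillars π 1 ∷ []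
successors-pillars₂ bar-last  n = refl
successors-pillars₂ bar-first n = refl
successors-pillars₂ bars      n = refl

successors-pillars₁ : ∀ π n → successors (2 + n) (pillars π 1) ≡ [] ∷ []
successors-pillars₁ bar-last  zero    = refl
successors-pillars₁ bar-last  (suc n) = refl
successors-pillars₁ bar-first zero    = refl
successors-pillars₁ bar-first (suc n) = refl
successors-pillars₁ bars      zero    = refl
successors-pillars₁ bars      (suc n) = refl

transfer-pillars : ∀ π n → transfer (3 + n) (pillars π 2) ≡ transfer (1 + n) []
transfer-pillars π n =
  trans (transfer-forced (2 + n) (pillars π 2) (pillars π 1) (successors-pillars₂ π n))
        (transfer-forced (1 + n) (pillars π 1) [] (successors-pillars₁ π n))

transfer-empty : ∀ n → transfer (4 + n) [] ≡ transfer (3 + n) [] + transfer (2 + n) [] + 3 * transfer (1 + n) []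
transfer-empty n = begin
  transfer (4 + n) []
    ≡⟨ cong (sum ∘ map T) (successors-empty n) ⟩
  T (pillars bar-last 2) + (T (pillars bar-first 2) + (T (slabPair 1) + (T (pillars bars 2) + (T [] + 0))))
    ≡⟨ cong₂ _+_ (transfer-pillars bar-last n)
         (cong₂ _+_ (transfer-pillars bar-first n)
           (cong₂ _+_ (transfer-forced (2 + n) (slabPair 1) [] (successors-slabPair n))
             (cong (_+ (T [] + 0)) (transfer-pillars bars n)))) ⟩
  t₁ + (t₁ + (t₂ + (t₁ + (t₃ + 0))))
    ≡⟨ rearrange t₃ t₂ t₁ ⟩
  t₃ + t₂ + 3 * t₁ ∎
  where
  open ≡-Reasoning
  T : List Brick → ℕ
  T = transfer (3 + n)
  t₃ t₂ t₁ : ℕ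
  t₃ = transfer (3 + n) []
  t₂ = transfer (2 + n) []
  t₁ = transfer (1 + n) []
  rearrange : ∀ x y z → z + (z + (y + (z + (x + 0)))) ≡ x + y + 3 * z
  rearrange = solve-∀

sumℤ-p-tail : ∀ m (k : ℕ → ℕ) (h : ℕ → ℤ) →
              sumℤ (map (λ i → p i ℤ.* h i) (applyUpTo (λ i → 4 + k i) m)) ≡ + 0
sumℤ-p-tail zero    k h = refl
sumℤ-p-tail (suc m) k h = cong₂ ℤ._+_ (*-zeroˡ (h (4 + k 0))) (sumℤ-p-tail m (k ∘ suc) h)

conv-p : ∀ (f : ℕ → ℤ) n → conv p f (4 + n) ≡ f (4 + n) ℤ.- f (3 + n) ℤ.- f (2 + n) ℤ.- + 3 ℤ.* f (1 + n)
conv-p f n = begin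
  conv p f (4 + n)
    ≡⟨ cong (λ t → + 1 ℤ.* f (4 + n) ℤ.+ (- + 1 ℤ.* f (3 + n) ℤ.+ (- + 1 ℤ.* f (2 + n) ℤ.+ (- + 3 ℤ.* f (1 + n) ℤ.+ t))))
            (sumℤ-p-tail (suc n) (λ i → i) (λ i → f (4 + n ∸ i))) ⟩
  + 1 ℤ.* f (4 + n) ℤ.+ (- + 1 ℤ.* f (3 + n) ℤ.+ (- + 1 ℤ.* f (2 + n) ℤ.+ (- + 3 ℤ.* f (1 + n) ℤ.+ + 0)))
    ≡⟨ expand (f (4 + n)) (f (3 + n)) (f (2 + n)) (f (1 + n)) ⟩
  f (4 + n) ℤ.- f (3 + n) ℤ.- f (2 + n) ℤ.- + 3 ℤ.* f (1 + n) ∎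
  where
  open ≡-Reasoning
  expand : ∀ w x y z → + 1 ℤ.* w ℤ.+ (- + 1 ℤ.* x ℤ.+ (- + 1 ℤ.* y ℤ.+ (- + 3 ℤ.* z ℤ.+ + 0)))
                       ≡ w ℤ.- x ℤ.- y ℤ.- + 3 ℤ.* z
  expand = ℤ-Solver.solve-∀

conv-p≡one : (f : ℕ → ℕ) → f 0 ≡ 1 → f 1 ≡ 1 → f 2 ≡ 2 → f 3 ≡ 6 →
             (∀ n → f (4 + n) ≡ f (3 + n) + f (2 + n) + 3 * f (1 + n)) →
             ∀ N → conv p (λ n → + f n) N ≡ one N
conv-p≡one f f₀ f₁ f₂ f₃ recurrence 0 rewrite f₀ = refl
conv-p≡one f f₀ f₁ f₂ f₃ recurrence 1 rewrite f₀ | f₁ = refl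
conv-p≡one f f₀ f₁ f₂ f₃ recurrence 2 rewrite f₀ | f₁ | f₂ = refl
conv-p≡one f f₀ f₁ f₂ f₃ recurrence 3 rewrite f₀ | f₁ | f₂ | f₃ = refl
conv-p≡one f f₀ f₁ f₂ f₃ recurrence (suc (suc (suc (suc n)))) = begin
  conv p (λ n → + f n) (4 + n)
    ≡⟨ conv-p (λ n → + f n) n ⟩
  + f (4 + n) ℤ.- + f (3 + n) ℤ.- + f (2 + n) ℤ.- + 3 ℤ.* + f (1 + n)
    ≡⟨ cong (λ t → t ℤ.- + f (3 + n) ℤ.- + f (2 + n) ℤ.- + 3 ℤ.* + f (1 + n)) lift ⟩
  (+ f (3 + n) ℤ.+ + f (2 + n) ℤ.+ + 3 ℤ.* + f (1 + n))
    ℤ.- + f (3 + n) ℤ.- + f (2 + n) ℤ.- + 3 ℤ.* + f (1 + n)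
    ≡⟨ cancel (+ f (3 + n)) (+ f (2 + n)) (+ f (1 + n)) ⟩
  + 0 ∎
  where
  open ≡-Reasoning
  lift : + f (4 + n) ≡ + f (3 + n) ℤ.+ + f (2 + n) ℤ.+ + 3 ℤ.* + f (1 + n)
  lift = begin
    + f (4 + n)                                             ≡⟨ cong +_ (recurrence n) ⟩
    + (f (3 + n) + f (2 + n) + 3 * f (1 + n))               ≡⟨ pos-+ (f (3 + n) + f (2 + n)) (3 * f (1 + n)) ⟩
    + (f (3 + n) + f (2 + n)) ℤ.+ + (3 * f (1 + n))
      ≡⟨ cong₂ ℤ._+_ (pos-+ (f (3 + n)) (f (2 + n))) (pos-* 3 (f (1 + n))) ⟩
    + f (3 + n) ℤ.+ + f (2 + n) ℤ.+ + 3 ℤ.* + f (1 + n) ∎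
  cancel : ∀ x y z → (x ℤ.+ y ℤ.+ + 3 ℤ.* z) ℤ.- x ℤ.- y ℤ.- + 3 ℤ.* z ≡ + 0
  cancel = ℤ-Solver.solve-∀

conv-cong : ∀ (h : ℕ → ℤ) {f g : ℕ → ℤ} → (∀ n → f n ≡ g n) → ∀ N → conv h f N ≡ conv h g N
conv-cong h f≗g N = cong sumℤ (map-cong (λ i → cong (h i ℤ.*_) (f≗g (N ∸ i))) (upTo (suc N)))

mainTheorem18 : ∀ (N : ℕ) → conv p (λ n → + (a n)) N ≡ one N
mainTheorem18 N = begin
  conv p (λ n → + a n) N              ≡⟨ conv-cong p (cong +_ ∘ a≡transfer) N ⟩
  conv p (λ n → + transfer n []) N    ≡⟨ conv-p≡one (λ n → transfer n []) refl refl refl refl transfer-empty N ⟩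
  one N ∎
  where open ≡-Reasoning
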